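{- Let $F$ be a finite family of finite sets such that for every two non-empty disjoint subfamilies $\Gamma_1,\Gamma_2$ of $F$ with $\Gamma_1\cup\Gamma_2=F$ one has $\big|(\bigcap \Gamma_1)\setminus(\bigcup \Gamma_2)\big|=\big|(\bigcap \Gamma_2)\setminus(\bigcup \Gamma_1)\big|$. Then $F$ is uniform, i.e. all members of $F$ have the same cardinality.
   Context: For a non-empty subfamily $\Gamma$, $\bigcup\Gamma$ and $\bigcap\Gamma$ denote the union and intersection of its members. -}

module Defs where

open import Data.Nat using (ℕ)
open import Data.Fin using (Fin)
open import Data.List using (List; map; filter; allFin)
open import Data.Fin.Subset using (Subset; ⋃; ⋂)
open import Data.Fin.Subset.Properties using (_∈?_)

-- A finite family of finite sets: m members A 0 … A (m-1), each a subset
-- of a finite ground set Fin n.  A subfamily is given by a subset Γ of the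
-- index set Fin m.

members : ∀ {m n} → (Fin m → Subset n) → Subset m → List (Subset n)
members {m} A Γ = map A (filter (_∈? Γ) (allFin m))

-- ⋃ Γ and ⋂ Γ (only used for non-empty Γ).
bigUnion : ∀ {m n} → (Fin m → Subset n) → Subset m → Subset n
bigUnion A Γ = ⋃ (members A Γ)

bigInter : ∀ {m n} → (Fin m → Subset n) → Subset m → Subset n
bigInter A Γ = ⋂ (members A Γ)

-- Venn-diagram count.  The profile of a point x is {k | x ∈ A k}; the atom
-- D(S) = ⋂S ∖ ⋃(∁S) is exactly the set of points of profile S, so sums over
-- the ground set regroup by atoms, and |A i ∖ A j| = Σ_{S ∋ i, S ∌ j} |D(S)|.
-- Complementation permutes the subsets of Fin m and swaps {S ∋ i, ∌ j} with
-- {S ∋ j, ∌ i}; for such S, S and ∁S are non-empty, so |D(S)| = |D(∁S)| by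
-- hypothesis.
module Submission where

open import Defs
open import Data.Nat using (ℕ)
open import Data.Fin using (Fin)
open import Data.Fin.Subset using (Subset; Nonempty; _∩_; _∪_; _─_; ∣_∣; ⊥; ⊤)
open import Function.Definitions using (Injective)
open import Relation.Binary.PropositionalEquality using (_≡_)

open import Data.Nat using (zero; suc; _+_; _*_)
open import Data.Nat.Properties
  using (+-comm; +-assoc; +-suc; *-zeroʳ; *-identityʳ; +-identityʳ; +-0-monoid; +-*-semiring)
open import Data.Fin using (zero; suc)
open import Data.Bool using (Bool; true; false; not; _∧_; _∨_)
open import Data.Bool.Properties using (∧-zeroʳ; ∧-identityʳ; not-involutive)
open import Data.Vec using ([]; _∷_; lookup; tabulate)
open import Data.Vec.Properties
  using (lookup-map; lookup-zipWith; lookup-replicate; lookup∘tabulate; lookup⇒[]=; map-∘; map-cong; map-id)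
open import Data.List using (List; []; _∷_; filter; allFin)
open import Data.Bool.ListAction using (and; all; any)
import Data.List as List
open import Data.List.Properties using (map-tabulate)
open import Data.Fin.Subset using (∁; ⋂; ⋃)
open import Data.Fin.Subset.Properties using (_∈?_; ∩-comm; ∩-inverseʳ; ∪-inverseʳ)
open import Data.Product using (_,_)
open import Relation.Nullary using (yes; no; does)
open import Relation.Binary.PropositionalEquality
  using (refl; sym; trans; cong; cong₂; module ≡-Reasoning)
open import Algebra.Properties.Monoid.Sum +-0-monoid using (sum-syntax; sum-cong-≗)
open import Algebra.Properties.Semiring.Sum +-*-semiring using (*-distribˡ-sum)

open ≡-Reasoning

ind : Bool → ℕ
ind true  = 1
ind false = 0

card-as-sum : ∀ {n} (p : Subset n) → ∣ p ∣ ≡ ∑[ x < n ] ind (lookup p x)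
card-as-sum []          = refl
card-as-sum (true ∷ p)  = cong suc (card-as-sum p)
card-as-sum (false ∷ p) = card-as-sum p

card-split : ∀ {n} (p q : Subset n) → ∣ p ∣ ≡ ∣ p ∩ q ∣ + ∣ p ─ q ∣
card-split []          []          = refl
card-split (true ∷ p)  (true ∷ q)  = cong suc (card-split p q)
card-split (true ∷ p)  (false ∷ q) = trans (cong suc (card-split p q)) (sym (+-suc _ _))
card-split (false ∷ p) (true ∷ q)  = card-split p q
card-split (false ∷ p) (false ∷ q) = card-split p q

lookup-─ : ∀ {n} (p q : Subset n) (x : Fin n) → lookup (p ─ q) x ≡ lookup p x ∧ not (lookup q x)
lookup-─ (a ∷ p) (true ∷ q)  zero    = sym (∧-zeroʳ a)
lookup-─ (a ∷ p) (false ∷ q) zero    = sym (∧-identityʳ a)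
lookup-─ (a ∷ p) (b ∷ q)     (suc x) = lookup-─ p q x

∁-involutive : ∀ {m} (S : Subset m) → ∁ (∁ S) ≡ S
∁-involutive S = trans (sym (map-∘ not not S)) (trans (map-cong not-involutive S) (map-id S))

∈?-lookup : ∀ {m} (k : Fin m) (S : Subset m) → does (k ∈? S) ≡ lookup S k
∈?-lookup zero    (true ∷ S)  = refl
∈?-lookup zero    (false ∷ S) = refl
∈?-lookup (suc k) (s ∷ S)     = ∈?-lookup k S

∑ˢ : ∀ {m} → (Subset m → ℕ) → ℕ
∑ˢ {zero}  f = f []
∑ˢ {suc m} f = ∑ˢ (λ S → f (true ∷ S)) + ∑ˢ (λ S → f (false ∷ S))

∑ˢ-cong : ∀ {m} {f g : Subset m → ℕ} → (∀ S → f S ≡ g S) → ∑ˢ f ≡ ∑ˢ g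
∑ˢ-cong {zero}  f≗g = f≗g []
∑ˢ-cong {suc m} f≗g = cong₂ _+_ (∑ˢ-cong (λ S → f≗g (true ∷ S))) (∑ˢ-cong (λ S → f≗g (false ∷ S)))

∑ˢ-zero : ∀ {m} → ∑ˢ {m} (λ _ → 0) ≡ 0
∑ˢ-zero {zero}  = refl
∑ˢ-zero {suc m} = cong₂ _+_ (∑ˢ-zero {m}) (∑ˢ-zero {m})

∑ˢ-*-zero : ∀ {m} (f : Subset m → ℕ) → ∑ˢ (λ S → f S * 0) ≡ 0
∑ˢ-*-zero {m} f = trans (∑ˢ-cong (λ S → *-zeroʳ (f S))) (∑ˢ-zero {m})

+-interchange : ∀ a b c d → (a + b) + (c + d) ≡ (a + c) + (b + d)
+-interchange a b c d = begin
  (a + b) + (c + d)   ≡⟨ +-assoc a b (c + d) ⟩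
  a + (b + (c + d))   ≡⟨ cong (a +_) (sym (+-assoc b c d)) ⟩
  a + ((b + c) + d)   ≡⟨ cong (λ u → a + (u + d)) (+-comm b c) ⟩
  a + ((c + b) + d)   ≡⟨ cong (a +_) (+-assoc c b d) ⟩
  a + (c + (b + d))   ≡⟨ sym (+-assoc a c (b + d)) ⟩
  (a + c) + (b + d)   ∎

∑ˢ-distrib-+ : ∀ {m} (f g : Subset m → ℕ) → ∑ˢ (λ S → f S + g S) ≡ ∑ˢ f + ∑ˢ g
∑ˢ-distrib-+ {zero}  f g = refl
∑ˢ-distrib-+ {suc m} f g = trans
  (cong₂ _+_ (∑ˢ-distrib-+ (λ S → f (true ∷ S)) (λ S → g (true ∷ S)))
             (∑ˢ-distrib-+ (λ S → f (false ∷ S)) (λ S → g (false ∷ S))))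
  (+-interchange (∑ˢ (λ S → f (true ∷ S))) (∑ˢ (λ S → g (true ∷ S)))
                 (∑ˢ (λ S → f (false ∷ S))) (∑ˢ (λ S → g (false ∷ S))))

∑ˢ-∁ : ∀ {m} (f : Subset m → ℕ) → ∑ˢ (λ S → f (∁ S)) ≡ ∑ˢ f
∑ˢ-∁ {zero}  f = refl
∑ˢ-∁ {suc m} f = trans
  (cong₂ _+_ (∑ˢ-∁ (λ S → f (false ∷ S))) (∑ˢ-∁ (λ S → f (true ∷ S))))
  (+-comm (∑ˢ (λ S → f (false ∷ S))) (∑ˢ (λ S → f (true ∷ S))))

∑-∑ˢ-comm : ∀ {m n} (h : Fin n → Subset m → ℕ) →
  ∑[ x < n ] ∑ˢ (h x) ≡ ∑ˢ (λ S → ∑[ x < n ] h x S)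
∑-∑ˢ-comm {m} {zero}  h = sym (∑ˢ-zero {m})
∑-∑ˢ-comm {m} {suc n} h = trans
  (cong (∑ˢ (h zero) +_) (∑-∑ˢ-comm (λ x → h (suc x))))
  (sym (∑ˢ-distrib-+ (h zero) (λ S → ∑[ x < n ] h (suc x) S)))

_⇔ᵇ_ : Bool → Bool → Bool
true  ⇔ᵇ b = b
false ⇔ᵇ b = not b

_≐_ : ∀ {m} → Subset m → Subset m → Bool
[]      ≐ []      = true
(a ∷ S) ≐ (b ∷ T) = (a ⇔ᵇ b) ∧ (S ≐ T)

∑ˢ-delta : ∀ {m} (T : Subset m) (f : Subset m → ℕ) → ∑ˢ (λ S → f S * ind (S ≐ T)) ≡ f T
∑ˢ-delta []          f = *-identityʳ (f [])
∑ˢ-delta (true ∷ T)  f = trans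
  (cong₂ _+_ (∑ˢ-delta T (λ S → f (true ∷ S))) (∑ˢ-*-zero (λ S → f (false ∷ S))))
  (+-identityʳ _)
∑ˢ-delta (false ∷ T) f = trans
  (cong (_+ ∑ˢ (λ S → f (false ∷ S) * ind (S ≐ T))) (∑ˢ-*-zero (λ S → f (true ∷ S))))
  (∑ˢ-delta T (λ S → f (false ∷ S)))

sum-by-fibres : ∀ {m n} (τ : Fin n → Subset m) (f : Subset m → ℕ) →
  ∑[ x < n ] f (τ x) ≡ ∑ˢ (λ S → f S * ∑[ x < n ] ind (S ≐ τ x))
sum-by-fibres {n = n} τ f = begin
  ∑[ x < n ] f (τ x)
    ≡⟨ sum-cong-≗ (λ x → sym (∑ˢ-delta (τ x) f)) ⟩
  ∑[ x < n ] ∑ˢ (λ S → f S * ind (S ≐ τ x))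
    ≡⟨ ∑-∑ˢ-comm (λ x S → f S * ind (S ≐ τ x)) ⟩
  ∑ˢ (λ S → ∑[ x < n ] (f S * ind (S ≐ τ x)))
    ≡⟨ ∑ˢ-cong (λ S → sym (*-distribˡ-sum (f S) (λ x → ind (S ≐ τ x)))) ⟩
  ∑ˢ (λ S → f S * ∑[ x < n ] ind (S ≐ τ x))
    ∎

-- One index of the atom test: "k ∈ S ⇒ x ∈ A k" and "k ∉ S ⇒ x ∉ A k"
-- together say that k ∈ S ⇔ x ∈ A k (with s = [k ∈ S], c = [x ∈ A k]).
atom-step : ∀ s c F G → ((not s ∨ c) ∧ F) ∧ not ((not s ∧ c) ∨ G) ≡ (s ⇔ᵇ c) ∧ (F ∧ not G)
atom-step true  true  F G = refl
atom-step true  false F G = refl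
atom-step false true  F G = ∧-zeroʳ F
atom-step false false F G = refl

-- The Boolean form of x ∈ ⋂S ∖ ⋃(∁S), where c k = [x ∈ A k], is
-- "k ∈ S ⇔ c k for every k".
atom-test : ∀ {m} (S : Subset m) (c : Fin m → Bool) (l : List (Fin m)) →
  all (λ k → not (lookup S k) ∨ c k) l ∧ not (any (λ k → lookup (∁ S) k ∧ c k) l)
    ≡ all (λ k → lookup S k ⇔ᵇ c k) l
atom-test S c [] = refl
atom-test S c (k ∷ l) = begin
  ((not s ∨ c k) ∧ F) ∧ not ((lookup (∁ S) k ∧ c k) ∨ G)
    ≡⟨ cong (λ t → ((not s ∨ c k) ∧ F) ∧ not ((t ∧ c k) ∨ G)) (lookup-map k not S) ⟩
  ((not s ∨ c k) ∧ F) ∧ not ((not s ∧ c k) ∨ G)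
    ≡⟨ atom-step s (c k) F G ⟩
  (s ⇔ᵇ c k) ∧ (F ∧ not G)
    ≡⟨ cong ((s ⇔ᵇ c k) ∧_) (atom-test S c l) ⟩
  (s ⇔ᵇ c k) ∧ all (λ k → lookup S k ⇔ᵇ c k) l
    ∎
  where
  s = lookup S k
  F = all (λ k → not (lookup S k) ∨ c k) l
  G = any (λ k → lookup (∁ S) k ∧ c k) l

all-⇔ᵇ : ∀ {m} (S : Subset m) (c : Fin m → Bool) →
  and (List.tabulate (λ k → lookup S k ⇔ᵇ c k)) ≡ S ≐ tabulate c
all-⇔ᵇ []      c = refl
all-⇔ᵇ (s ∷ S) c = cong ((s ⇔ᵇ c zero) ∧_) (all-⇔ᵇ S (λ k → c (suc k)))

module Atoms {m n : ℕ} (A : Fin m → Subset n) where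

  profile : Fin n → Subset m
  profile x = tabulate (λ k → lookup (A k) x)

  atom : Subset m → Subset n
  atom S = bigInter A S ─ bigUnion A (∁ S)

  inter-lookup : (S : Subset m) (x : Fin n) (l : List (Fin m)) →
    lookup (⋂ (List.map A (filter (_∈? S) l))) x ≡ all (λ k → not (lookup S k) ∨ lookup (A k) x) l
  inter-lookup S x [] = lookup-replicate x true
  inter-lookup S x (k ∷ l) with k ∈? S | ∈?-lookup k S
  ... | yes _ | k∈S rewrite sym k∈S =
    trans (lookup-zipWith _∧_ x (A k) _) (cong (lookup (A k) x ∧_) (inter-lookup S x l))
  ... | no _  | k∉S rewrite sym k∉S = inter-lookup S x l

  union-lookup : (T : Subset m) (x : Fin n) (l : List (Fin m)) →
    lookup (⋃ (List.map A (filter (_∈? T) l))) x ≡ any (λ k → lookup T k ∧ lookup (A k) x) l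
  union-lookup T x [] = lookup-replicate x false
  union-lookup T x (k ∷ l) with k ∈? T | ∈?-lookup k T
  ... | yes _ | k∈T rewrite sym k∈T =
    trans (lookup-zipWith _∨_ x (A k) _) (cong (lookup (A k) x ∨_) (union-lookup T x l))
  ... | no _  | k∉T rewrite sym k∉T = union-lookup T x l

  atom-membership : (S : Subset m) (x : Fin n) → lookup (atom S) x ≡ S ≐ profile x
  atom-membership S x = begin
    lookup (atom S) x
      ≡⟨ lookup-─ (bigInter A S) (bigUnion A (∁ S)) x ⟩
    lookup (bigInter A S) x ∧ not (lookup (bigUnion A (∁ S)) x)
      ≡⟨ cong₂ (λ u v → u ∧ not v) (inter-lookup S x (allFin m)) (union-lookup (∁ S) x (allFin m)) ⟩
    all (λ k → not (lookup S k) ∨ a k) (allFin m) ∧ not (any (λ k → lookup (∁ S) k ∧ a k) (allFin m))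
      ≡⟨ atom-test S a (allFin m) ⟩
    and (List.map (λ k → lookup S k ⇔ᵇ a k) (List.tabulate (λ k → k)))
      ≡⟨ cong and (map-tabulate (λ k → k) (λ k → lookup S k ⇔ᵇ a k)) ⟩
    and (List.tabulate (λ k → lookup S k ⇔ᵇ a k))
      ≡⟨ all-⇔ᵇ S a ⟩
    S ≐ profile x
      ∎
    where
    a : Fin m → Bool
    a k = lookup (A k) x

  sum-by-atoms : (f : Subset m → ℕ) → ∑[ x < n ] f (profile x) ≡ ∑ˢ (λ S → f S * ∣ atom S ∣)
  sum-by-atoms f = trans (sum-by-fibres profile f) (∑ˢ-cong (λ S → cong (f S *_) (sym (
    trans (card-as-sum (atom S)) (sum-cong-≗ (λ x → cong ind (atom-membership S x)))))))

  separates : Fin m → Fin m → Subset m → ℕ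
  separates i j S = ind (lookup S i ∧ not (lookup S j))

  difference-by-atoms : (i j : Fin m) → ∣ A i ─ A j ∣ ≡ ∑ˢ (λ S → separates i j S * ∣ atom S ∣)
  difference-by-atoms i j = begin
    ∣ A i ─ A j ∣
      ≡⟨ card-as-sum (A i ─ A j) ⟩
    ∑[ x < n ] ind (lookup (A i ─ A j) x)
      ≡⟨ sum-cong-≗ (λ x → cong ind (lookup-─ (A i) (A j) x)) ⟩
    ∑[ x < n ] ind (lookup (A i) x ∧ not (lookup (A j) x))
      ≡⟨ sum-cong-≗ (λ x → sym (cong₂ (λ u v → ind (u ∧ not v))
           (lookup∘tabulate (λ k → lookup (A k) x) i) (lookup∘tabulate (λ k → lookup (A k) x) j))) ⟩
    ∑[ x < n ] separates i j (profile x)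
      ≡⟨ sum-by-atoms (separates i j) ⟩
    ∑ˢ (λ S → separates i j S * ∣ atom S ∣)
      ∎

  Balanced : Set
  Balanced = (Γ₁ Γ₂ : Subset m) → Nonempty Γ₁ → Nonempty Γ₂ →
    Γ₁ ∩ Γ₂ ≡ ⊥ → Γ₁ ∪ Γ₂ ≡ ⊤ →
    ∣ bigInter A Γ₁ ─ bigUnion A Γ₂ ∣ ≡ ∣ bigInter A Γ₂ ─ bigUnion A Γ₁ ∣

  atom-∁ : Balanced → (S : Subset m) → Nonempty S → Nonempty (∁ S) → ∣ atom (∁ S) ∣ ≡ ∣ atom S ∣
  atom-∁ balanced S S≠∅ ∁S≠∅ = sym (trans
    (balanced S (∁ S) S≠∅ ∁S≠∅ (∩-inverseʳ S) (∪-inverseʳ S))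
    (cong (λ T → ∣ bigInter A (∁ S) ─ bigUnion A T ∣) (sym (∁-involutive S))))

  separates-∁ : Balanced → (i j : Fin m) (S : Subset m) →
    separates i j (∁ S) * ∣ atom (∁ S) ∣ ≡ separates j i S * ∣ atom S ∣
  separates-∁ balanced i j S
    rewrite lookup-map i not S | lookup-map j not S
    with lookup S i in Si | lookup S j in Sj
  ... | true  | true  = refl
  ... | true  | false = refl
  ... | false | false = refl
  ... | false | true  = cong (_+ 0) (atom-∁ balanced S
    (j , lookup⇒[]= j S Sj)
    (i , lookup⇒[]= i (∁ S) (trans (lookup-map i not S) (cong not Si))))

  difference-symmetric : Balanced → (i j : Fin m) → ∣ A i ─ A j ∣ ≡ ∣ A j ─ A i ∣
  difference-symmetric balanced i j = begin
    ∣ A i ─ A j ∣                                        ≡⟨ difference-by-atoms i j ⟩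
    ∑ˢ (λ S → separates i j S * ∣ atom S ∣)               ≡⟨ sym (∑ˢ-∁ (λ S → separates i j S * ∣ atom S ∣)) ⟩
    ∑ˢ (λ S → separates i j (∁ S) * ∣ atom (∁ S) ∣)       ≡⟨ ∑ˢ-cong (separates-∁ balanced i j) ⟩
    ∑ˢ (λ S → separates j i S * ∣ atom S ∣)               ≡⟨ sym (difference-by-atoms j i) ⟩
    ∣ A j ─ A i ∣                                        ∎

proposition2p4 : (m n : ℕ) (A : Fin m → Subset n) →
  Injective _≡_ _≡_ A →
  ((Γ₁ Γ₂ : Subset m) → Nonempty Γ₁ → Nonempty Γ₂ →
    Γ₁ ∩ Γ₂ ≡ ⊥ → Γ₁ ∪ Γ₂ ≡ ⊤ →
    ∣ bigInter A Γ₁ ─ bigUnion A Γ₂ ∣ ≡ ∣ bigInter A Γ₂ ─ bigUnion A Γ₁ ∣) →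
  (i j : Fin m) → ∣ A i ∣ ≡ ∣ A j ∣
proposition2p4 m n A _ balanced i j = begin
  ∣ A i ∣                        ≡⟨ card-split (A i) (A j) ⟩
  ∣ A i ∩ A j ∣ + ∣ A i ─ A j ∣  ≡⟨ cong₂ _+_ (cong ∣_∣ (∩-comm (A i) (A j))) (difference-symmetric balanced i j) ⟩
  ∣ A j ∩ A i ∣ + ∣ A j ─ A i ∣  ≡⟨ sym (card-split (A j) (A i)) ⟩
  ∣ A j ∣                        ∎
  where open Atoms A
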